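{- For all $n\in\omega$ and all interpretation variables $k$: $${\sf FIL}\vdash(A_n\rhd^k B_n\wedge\mathsf X_{n-1})\wedge\mathsf Y_n\to\Diamond^k\mathsf Z_n,$$ where, for arbitrary ${\sf FIL}$-formulas $A_i,B_i,C_i,E_i$: $\mathsf X_{ -1}:=\top$, $\mathsf X_0:=A_0\rhd B_0$, $\mathsf X_{m+1}:=A_{m+1}\rhd B_{m+1}\wedge\mathsf X_m$; $\mathsf Y_0:=\neg(A_0\rhd\neg C_0)$, $\mathsf Y_{m+1}:=\neg(A_{m+1}\rhd\neg C_{m+1})\wedge(E_{m+1}\rhd\mathsf Y_m)$; $\mathsf Z_0:=B_0\wedge\Box C_0$, $\mathsf Z_{m+1}:=B_{m+1}\wedge\mathsf X_m\wedge\Box C_{m+1}\wedge(E_{m+1}\rhd A_m)\wedge(E_{m+1}\rhd\mathsf Z_m)$.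
   Context: The logic ${\sf FIL}$: the language has propositional variables, interpretation variables $k_0,k_1,\dots$, one interpretation constant ${\sf id}$, $\top,\bot$, Boolean connectives and modalities $\Box^{\mathfrak a}A$, $A\rhd^{\mathfrak a}B$ where $\mathfrak a$ is a finite sequence of interpretation terms without repetition; unlabelled $\Box,\rhd$ stand for label ${\sf id}$ / the empty sequence; $\Diamond^{\mathfrak a}:=\neg\Box^{\mathfrak a}\neg$; $\mathfrak a,k$ is $\mathfrak a$ extended by $k$. Sequents $\Gamma\vdash C$ with $\Gamma$ a multiset, with $\Gamma,\Delta\vdash C$ iff $\Delta\vdash\bigwedge\Gamma\to C$. Axioms/rules (for all labels $\mathfrak a,\mathfrak b$, terms $k$): all tautologies; modus ponens; $\Box^{\mathfrak a}(A\to B)\to(\Box^{\mathfrak a}A\to\Box^{\mathfrak a}B)$; $\Box^{\mathfrak b}A\to\Box^{\mathfrak a}\Box^{\mathfrak b}A$; $\Box^{\mathfrak a}(\Box^{\mathfrak a}A\to A)\to\Box^{\mathfrak a}A$; $\Box^{\mathfrak a}(A\to B)\to A\rhd^{\mathfrak a}B$; $(A\rhd B)\wedge(B\rhd^{\mathfrak a}C)\to A\rhd^{\mathfrak a}C$; $(A\rhd^{\mathfrak a}B)\wedge\Box^{\mathfrak a}(B\to C)\to A\rhd^{\mathfrak a}C$; $(A\rhd^{\mathfrak a}C)\wedge(B\rhd^{\mathfrak a}C)\to A\vee B\rhd^{\mathfrak a}C$; $A\rhd^{\mathfrak a}B\to(\Diamond A\to\Diamond^{\mathfrak a}B)$; $A\rhd^{\mathfrak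 a}\Diamond^{\mathfrak b}B\to A\rhd^{\mathfrak b}B$; $\Box^{\mathfrak a,k}A\to\Box^{\mathfrak a}A$; $A\rhd^{\mathfrak a}B\to A\rhd^{\mathfrak a,k}B$; necessitation $\vdash A\Rightarrow\vdash\Box^{\mathfrak a}A$; rule $\mathsf P^{\mathfrak a,\mathfrak b,k}$: from $\Gamma,\Delta,\Box^{\mathfrak b}(A\rhd^{\mathfrak a,k}B)\vdash C$ infer $\Gamma,A\rhd^{\mathfrak a}B\vdash C$, provided $k$ is an interpretation variable not occurring in $\mathfrak a,\Gamma,A,B,C$ and $\Delta$ consists of formulas of the forms $E\rhd^{\mathfrak a,k}F\to E\rhd^{\mathfrak a}F$ and $\Box^{\mathfrak a}E\to\Box^{\mathfrak a,k}E$. Binding: $\neg,\Box,\Diamond$ strongest, Boolean connectives other than $\to$ bind stronger than $\rhd$, $\rhd$ stronger than $\to$. -}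

module Defs where

open import Data.Nat using (ℕ; zero; suc)
open import Data.Bool using (Bool; true; false; _∧_; _∨_; not)
open import Data.List using (List; []; _∷_; _++_)
open import Data.List.Relation.Unary.All using (All)
open import Data.List.Relation.Unary.Unique.Propositional using (Unique)
open import Data.List.Membership.Propositional using (_∈_; _∉_)
open import Data.Sum using (_⊎_)
open import Data.Empty using (⊥)
open import Relation.Binary.PropositionalEquality using (_≡_; _≢_)
open import Relation.Nullary using (¬_)

data Term : Set where
  ivar : ℕ → Term
  iid  : Term

-- Convention: the sequence 𝔞,k (𝔞 extended by k) is stored as  k ∷ 𝔞
-- (the last element of the sequence is the head of the list).

record Label : Set where
  constructor mkLabel
  field
    seq   : List Term
    .uniq : Unique seq
open Label public

ε : Label
ε = mkLabel [] Unique.[]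

extend : (a : Label) (k : Term) → .(k ∉ seq a) → Label
extend (mkLabel s u) k k∉ = mkLabel (k ∷ s) (allNe k∉ Unique.∷ u)
  where
  allNe : ∀ {x : Term} {l : List Term} → .(x ∉ l) → All (x ≢_) l
  allNe {l = []} _ = All.[]
  allNe {x} {l = y ∷ l} nin =
    (λ eq → ⊥-irr (nin (Data.List.Relation.Unary.Any.here eq)))
    All.∷ allNe (λ m → nin (Data.List.Relation.Unary.Any.there m))
    where
    open import Data.List.Relation.Unary.Any
    ⊥-irr : .⊥ → ⊥
    ⊥-irr ()

single : Term → Label
single k = mkLabel (k ∷ []) (All.[] Unique.∷ Unique.[])

infixr 20 ~_
infixr 20 □⟨_⟩_
infixl 15 _∧'_
infixl 14 _∨'_
infix  12 _▷⟨_⟩_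
infixr 10 _⇒_

data Formula : Set where
  pvar   : ℕ → Formula
  ⊤'     : Formula
  ⊥'     : Formula
  ~_     : Formula → Formula
  _∧'_   : Formula → Formula → Formula
  _∨'_   : Formula → Formula → Formula
  _⇒_    : Formula → Formula → Formula
  □⟨_⟩_  : Label → Formula → Formula
  _▷⟨_⟩_ : Formula → Label → Formula → Formula

◇⟨_⟩_ : Label → Formula → Formula
◇⟨ a ⟩ A = ~ □⟨ a ⟩ (~ A)

□_ : Formula → Formula
□ A = □⟨ ε ⟩ A

◇_ : Formula → Formula
◇ A = ◇⟨ ε ⟩ A

_▷_ : Formula → Formula → Formula
A ▷ B = A ▷⟨ ε ⟩ B

infixr 20 □_ ◇_ ◇⟨_⟩_
infix  12 _▷_

⋀ : List Formula → Formula
⋀ []       = ⊤'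
⋀ (A ∷ Γ)  = A ∧' ⋀ Γ

-- Tautologies: true under every Boolean valuation of the maximal
-- non-Boolean subformulas (propositional variables and modal formulas).

eval : (Formula → Bool) → Formula → Bool
eval v (pvar p)       = v (pvar p)
eval v ⊤'             = true
eval v ⊥'             = false
eval v (~ A)          = not (eval v A)
eval v (A ∧' B)       = eval v A ∧ eval v B
eval v (A ∨' B)       = eval v A ∨ eval v B
eval v (A ⇒ B)        = not (eval v A) ∨ eval v B
eval v (□⟨ a ⟩ A)     = v (□⟨ a ⟩ A)
eval v (A ▷⟨ a ⟩ B)   = v (A ▷⟨ a ⟩ B)

Tautology : Formula → Set
Tautology A = ∀ (v : Formula → Bool) → eval v A ≡ true

Occurs : ℕ → Formula → Set
Occurs k (pvar p)     = ⊥
Occurs k ⊤'           = ⊥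
Occurs k ⊥'           = ⊥
Occurs k (~ A)        = Occurs k A
Occurs k (A ∧' B)     = Occurs k A ⊎ Occurs k B
Occurs k (A ∨' B)     = Occurs k A ⊎ Occurs k B
Occurs k (A ⇒ B)      = Occurs k A ⊎ Occurs k B
Occurs k (□⟨ a ⟩ A)   = ivar k ∈ seq a ⊎ Occurs k A
Occurs k (A ▷⟨ a ⟩ B) = Occurs k A ⊎ ivar k ∈ seq a ⊎ Occurs k B

data PSide (a : Label) (k : ℕ) .(k∉ : ivar k ∉ seq a) : Formula → Set where
  rhd-side : ∀ E F → PSide a k k∉ (E ▷⟨ extend a (ivar k) k∉ ⟩ F ⇒ E ▷⟨ a ⟩ F)
  box-side : ∀ E   → PSide a k k∉ (□⟨ a ⟩ E ⇒ □⟨ extend a (ivar k) k∉ ⟩ E)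

-- Provability in FIL.  A sequent  Γ ⊢ C  is  ⊢ ⋀Γ → C.

infix 5 FIL⊢_

data FIL⊢_ : Formula → Set where
  taut   : ∀ {A} → Tautology A → FIL⊢ A
  mp     : ∀ {A B} → FIL⊢ A ⇒ B → FIL⊢ A → FIL⊢ B
  axK    : ∀ a A B → FIL⊢ □⟨ a ⟩ (A ⇒ B) ⇒ (□⟨ a ⟩ A ⇒ □⟨ a ⟩ B)
  ax4    : ∀ a b A → FIL⊢ □⟨ b ⟩ A ⇒ □⟨ a ⟩ □⟨ b ⟩ A
  axL    : ∀ a A → FIL⊢ □⟨ a ⟩ (□⟨ a ⟩ A ⇒ A) ⇒ □⟨ a ⟩ A
  axJ1   : ∀ a A B → FIL⊢ □⟨ a ⟩ (A ⇒ B) ⇒ A ▷⟨ a ⟩ B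
  axJ2   : ∀ a A B C → FIL⊢ (A ▷ B) ∧' (B ▷⟨ a ⟩ C) ⇒ A ▷⟨ a ⟩ C
  axJ2'  : ∀ a A B C → FIL⊢ (A ▷⟨ a ⟩ B) ∧' □⟨ a ⟩ (B ⇒ C) ⇒ A ▷⟨ a ⟩ C
  axJ3   : ∀ a A B C → FIL⊢ (A ▷⟨ a ⟩ C) ∧' (B ▷⟨ a ⟩ C) ⇒ A ∨' B ▷⟨ a ⟩ C
  axJ4   : ∀ a A B → FIL⊢ A ▷⟨ a ⟩ B ⇒ (◇ A ⇒ ◇⟨ a ⟩ B)
  axJ5   : ∀ a b A B → FIL⊢ A ▷⟨ a ⟩ (◇⟨ b ⟩ B) ⇒ A ▷⟨ b ⟩ B
  axBoxK : ∀ a k A .(k∉ : k ∉ seq a) → FIL⊢ □⟨ extend a k k∉ ⟩ A ⇒ □⟨ a ⟩ A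
  axRhdK : ∀ a k A B .(k∉ : k ∉ seq a) → FIL⊢ A ▷⟨ a ⟩ B ⇒ A ▷⟨ extend a k k∉ ⟩ B
  nec    : ∀ a {A} → FIL⊢ A → FIL⊢ □⟨ a ⟩ A
  ruleP  : ∀ a b (k : ℕ) (Γ Δ : List Formula) A B C
           (k∉a : ivar k ∉ seq a)
           (k∉Γ : All (λ G → ¬ Occurs k G) Γ)
           (k∉A : ¬ Occurs k A) (k∉B : ¬ Occurs k B) (k∉C : ¬ Occurs k C)
           (Δok : All (PSide a k k∉a) Δ) →
           FIL⊢ ⋀ (Γ ++ Δ ++ (□⟨ b ⟩ (A ▷⟨ extend a (ivar k) k∉a ⟩ B) ∷ [])) ⇒ C →
           FIL⊢ ⋀ (Γ ++ (A ▷⟨ a ⟩ B ∷ [])) ⇒ C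

module Seqs (A B C E : ℕ → Formula) where

  X : ℕ → Formula
  X zero    = A zero ▷ B zero
  X (suc m) = A (suc m) ▷ (B (suc m) ∧' X m)

  Xpred : ℕ → Formula
  Xpred zero    = ⊤'
  Xpred (suc m) = X m

  Y : ℕ → Formula
  Y zero    = ~ (A zero ▷ ~ C zero)
  Y (suc m) = ~ (A (suc m) ▷ ~ C (suc m)) ∧' (E (suc m) ▷ Y m)

  Z : ℕ → Formula
  Z zero    = B zero ∧' □ C zero
  Z (suc m) = B (suc m) ∧' X m ∧' □ C (suc m)
              ∧' (E (suc m) ▷ A m) ∧' (E (suc m) ▷ Z m)

{-# OPTIONS --safe #-}
-- Induction on n, for all k at once.  The key fact: from A ▷^𝔟 B and ¬(A ▷ ¬C)
-- follows ◇^𝔟(B ∧ □C), since otherwise □^𝔟(B → ◇¬C), and J2′, J5 give A ▷ ¬C.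
-- For the step it therefore suffices to strengthen A_n ▷^k (B_n ∧ X_{n-1}) by the
-- conjuncts E_n ▷ A_{n-1} and E_n ▷ Z_{n-1}.  Rule P replaces E_n ▷ Y_{n-1} by
-- □^k(E_n ▷^f Y_{n-1}) with f fresh, so it is enough that E_n ▷^f Y_{n-1} and X_{n-1}
-- imply both.  The first follows from Y_{n-1} → ◇A_{n-1} and J5.  For the second,
-- rule P applied to X_{n-1} = A_{n-1} ▷ (…) gives □^f(A_{n-1} ▷^g (…)) with g fresh;
-- the induction hypothesis at g turns it into □^f(Y_{n-1} → ◇^g Z_{n-1}), hence
-- E_n ▷^g Z_{n-1} by J2′ and J5, and the side formula E_n ▷^g Z_{n-1} → E_n ▷ Z_{n-1}
-- of rule P removes the label g.

module Submission where

open import Defs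
open import Data.Nat using (ℕ; zero; suc; _⊔_; _≤_)
open import Data.Nat.Properties using (≤-refl; m≤n⇒m≤n⊔o; m≤n⇒m≤o⊔n; 1+n≰n)
open import Data.Fin using (Fin; zero; suc)
open import Data.Fin.Subset.Properties using (anySubset?)
open import Data.Vec using (Vec; []; _∷_; lookup; map)
open import Data.Vec.Properties using (lookup-map)
open import Data.Bool using (Bool; true; false; _∧_; _∨_; not; _≟_)
open import Data.Bool.Properties using (¬-not)
open import Data.List using (List; []; _∷_; _++_)
open import Data.List.Relation.Unary.All using (All; []; _∷_)
open import Data.List.Relation.Unary.Any using (here; there)
open import Data.List.Membership.Propositional using (_∈_)
open import Data.Product using (∃; _,_)
open import Data.Sum using (inj₁; inj₂)
open import Relation.Binary.PropositionalEquality using (_≡_; refl; sym; trans; cong; cong₂)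
open import Relation.Nullary using (¬_; Dec)
open import Relation.Nullary.Decidable using (False; toWitnessFalse)

infixr 6 _⊃_
infixl 8 _&_

data Schema (n : ℕ) : Set where
  var : Fin n → Schema n
  tt  : Schema n
  neg : Schema n → Schema n
  _&_ : Schema n → Schema n → Schema n
  _⊃_ : Schema n → Schema n → Schema n

⟦_⟧ : ∀ {n} → Schema n → Vec Formula n → Formula
⟦ var i ⟧ σ = lookup σ i
⟦ tt    ⟧ σ = ⊤'
⟦ neg φ ⟧ σ = ~ ⟦ φ ⟧ σ
⟦ φ & ψ ⟧ σ = ⟦ φ ⟧ σ ∧' ⟦ ψ ⟧ σ
⟦ φ ⊃ ψ ⟧ σ = ⟦ φ ⟧ σ ⇒ ⟦ ψ ⟧ σ

truth : ∀ {n} → Schema n → Vec Bool n → Bool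
truth (var i) bs = lookup bs i
truth tt      bs = true
truth (neg φ) bs = not (truth φ bs)
truth (φ & ψ) bs = truth φ bs ∧ truth ψ bs
truth (φ ⊃ ψ) bs = not (truth φ bs) ∨ truth ψ bs

eval-⟦⟧ : ∀ {n} v (φ : Schema n) σ → eval v (⟦ φ ⟧ σ) ≡ truth φ (map (eval v) σ)
eval-⟦⟧ v (var i) σ = sym (lookup-map i (eval v) σ)
eval-⟦⟧ v tt      σ = refl
eval-⟦⟧ v (neg φ) σ = cong not (eval-⟦⟧ v φ σ)
eval-⟦⟧ v (φ & ψ) σ = cong₂ _∧_ (eval-⟦⟧ v φ σ) (eval-⟦⟧ v ψ σ)
eval-⟦⟧ v (φ ⊃ ψ) σ = cong₂ (λ a b → not a ∨ b) (eval-⟦⟧ v φ σ) (eval-⟦⟧ v ψ σ)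

counterexample? : ∀ {n} (φ : Schema n) → Dec (∃ λ bs → truth φ bs ≡ false)
counterexample? φ = anySubset? (λ bs → truth φ bs ≟ false)

-- The implicit argument reduces to ⊤ exactly when the enumeration of all
-- valuations finds no counterexample, so valid instances need no proof term.
schema : ∀ {n} (φ : Schema n) (σ : Vec Formula n) {_ : False (counterexample? φ)} →
         FIL⊢ ⟦ φ ⟧ σ
schema φ σ {valid} = taut λ v →
  trans (eval-⟦⟧ v φ σ) (¬-not λ eq → toWitnessFalse valid (map (eval v) σ , eq))

p₀ : ∀ {n} → Schema (suc n)
p₀ = var zero

p₁ : ∀ {n} → Schema (suc (suc n))
p₁ = var (suc zero)

p₂ : ∀ {n} → Schema (suc (suc (suc n)))
p₂ = var (suc (suc zero))

p₃ : ∀ {n} → Schema (suc (suc (suc (suc n))))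
p₃ = var (suc (suc (suc zero)))

infixr 9 _⨾_

⇒-refl : ∀ {P} → FIL⊢ P ⇒ P
⇒-refl {P} = schema (p₀ ⊃ p₀) (P ∷ [])

_⨾_ : ∀ {P Q R} → FIL⊢ P ⇒ Q → FIL⊢ Q ⇒ R → FIL⊢ P ⇒ R
_⨾_ {P} {Q} {R} p⇒q q⇒r =
  mp (mp (schema ((p₀ ⊃ p₁) ⊃ (p₁ ⊃ p₂) ⊃ (p₀ ⊃ p₂)) (P ∷ Q ∷ R ∷ [])) p⇒q) q⇒r

⟨_,_⟩ : ∀ {H P Q} → FIL⊢ H ⇒ P → FIL⊢ H ⇒ Q → FIL⊢ H ⇒ P ∧' Q
⟨_,_⟩ {H} {P} {Q} h⇒p h⇒q =
  mp (mp (schema ((p₀ ⊃ p₁) ⊃ (p₀ ⊃ p₂) ⊃ (p₀ ⊃ p₁ & p₂)) (H ∷ P ∷ Q ∷ [])) h⇒p) h⇒q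

⇒-app : ∀ {H P Q} → FIL⊢ H ⇒ (P ⇒ Q) → FIL⊢ H ⇒ P → FIL⊢ H ⇒ Q
⇒-app {H} {P} {Q} h⇒p⇒q h⇒p =
  mp (mp (schema ((p₀ ⊃ p₁ ⊃ p₂) ⊃ (p₀ ⊃ p₁) ⊃ (p₀ ⊃ p₂)) (H ∷ P ∷ Q ∷ [])) h⇒p⇒q) h⇒p

⇒-const : ∀ {H P} → FIL⊢ P → FIL⊢ H ⇒ P
⇒-const {H} {P} ⊢p = mp (schema (p₁ ⊃ p₀ ⊃ p₁) (H ∷ P ∷ [])) ⊢p

⇒-curry : ∀ {P Q R} → FIL⊢ P ∧' Q ⇒ R → FIL⊢ P ⇒ (Q ⇒ R)
⇒-curry {P} {Q} {R} = mp (schema ((p₀ & p₁ ⊃ p₂) ⊃ (p₀ ⊃ p₁ ⊃ p₂)) (P ∷ Q ∷ R ∷ []))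

∧-elimˡ : ∀ {P Q} → FIL⊢ P ∧' Q ⇒ P
∧-elimˡ {P} {Q} = schema (p₀ & p₁ ⊃ p₀) (P ∷ Q ∷ [])

∧-elimʳ : ∀ {P Q} → FIL⊢ P ∧' Q ⇒ Q
∧-elimʳ {P} {Q} = schema (p₀ & p₁ ⊃ p₁) (P ∷ Q ∷ [])

contrapose : ∀ {P Q} → FIL⊢ P ⇒ Q → FIL⊢ ~ Q ⇒ ~ P
contrapose {P} {Q} = mp (schema ((p₀ ⊃ p₁) ⊃ (neg p₁ ⊃ neg p₀)) (P ∷ Q ∷ []))

□-mono : ∀ a {P Q} → FIL⊢ P ⇒ Q → FIL⊢ □⟨ a ⟩ P ⇒ □⟨ a ⟩ Q
□-mono a {P} {Q} p⇒q = mp (axK a P Q) (nec a p⇒q)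

◇-mono : ∀ a {P Q} → FIL⊢ P ⇒ Q → FIL⊢ ◇⟨ a ⟩ P ⇒ ◇⟨ a ⟩ Q
◇-mono a p⇒q = contrapose (□-mono a (contrapose p⇒q))

▷-monoʳ : ∀ a {A B B′} → FIL⊢ B ⇒ B′ → FIL⊢ A ▷⟨ a ⟩ B ⇒ A ▷⟨ a ⟩ B′
▷-monoʳ a {A} {B} {B′} b⇒b′ = ⟨ ⇒-refl , ⇒-const (nec a b⇒b′) ⟩ ⨾ axJ2' a A B B′

▷-relabel : ∀ a b {A B C} → FIL⊢ (A ▷⟨ a ⟩ B) ∧' □⟨ a ⟩ (B ⇒ ◇⟨ b ⟩ C) ⇒ A ▷⟨ b ⟩ C
▷-relabel a b {A} {B} {C} = axJ2' a A B (◇⟨ b ⟩ C) ⨾ axJ5 a b A C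

¬▷¬⇒◇ : ∀ A C → FIL⊢ ~ (A ▷ ~ C) ⇒ ◇ A
¬▷¬⇒◇ A C = contrapose (□-mono ε (schema (neg p₀ ⊃ p₀ ⊃ neg p₁) (A ∷ C ∷ [])) ⨾ axJ1 ε A (~ C))

▷∧¬▷¬⇒◇∧□ : ∀ a A B C → FIL⊢ (A ▷⟨ a ⟩ B) ∧' ~ (A ▷ ~ C) ⇒ ◇⟨ a ⟩ (B ∧' □ C)
▷∧¬▷¬⇒◇∧□ a A B C =
  mp (schema ((p₀ & p₁ ⊃ p₂) ⊃ (p₀ & neg p₂ ⊃ neg p₁)) (P ∷ Q ∷ R ∷ []))
     (⟨ ∧-elimˡ , ∧-elimʳ ⨾ □-mono a ¬[B∧□C]⇒B⇒◇¬C ⟩ ⨾ ▷-relabel a ε)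
  where
  P Q R : Formula
  P = A ▷⟨ a ⟩ B
  Q = □⟨ a ⟩ (~ (B ∧' □ C))
  R = A ▷ ~ C
  ¬[B∧□C]⇒B⇒◇¬C : FIL⊢ ~ (B ∧' □ C) ⇒ (B ⇒ ◇ (~ C))
  ¬[B∧□C]⇒B⇒◇¬C =
    mp (schema ((p₀ ⊃ p₁) ⊃ (neg (p₂ & p₁) ⊃ (p₂ ⊃ neg p₀))) (□ (~ ~ C) ∷ □ C ∷ B ∷ []))
       (□-mono ε (schema (neg (neg p₀) ⊃ p₀) (C ∷ [])))

maxVarₗ : List Term → ℕ
maxVarₗ []           = 0
maxVarₗ (ivar k ∷ l) = k ⊔ maxVarₗ l
maxVarₗ (iid ∷ l)    = maxVarₗ l

maxVar : Formula → ℕ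
maxVar (pvar _)     = 0
maxVar ⊤'           = 0
maxVar ⊥'           = 0
maxVar (~ A)        = maxVar A
maxVar (A ∧' B)     = maxVar A ⊔ maxVar B
maxVar (A ∨' B)     = maxVar A ⊔ maxVar B
maxVar (A ⇒ B)      = maxVar A ⊔ maxVar B
maxVar (□⟨ a ⟩ A)   = maxVarₗ (seq a) ⊔ maxVar A
maxVar (A ▷⟨ a ⟩ B) = maxVar A ⊔ (maxVarₗ (seq a) ⊔ maxVar B)

∈⇒≤maxVarₗ : ∀ {k} l → ivar k ∈ l → k ≤ maxVarₗ l
∈⇒≤maxVarₗ (ivar j ∷ l) (here refl) = m≤n⇒m≤n⊔o (maxVarₗ l) ≤-refl
∈⇒≤maxVarₗ (ivar j ∷ l) (there k∈l) = m≤n⇒m≤o⊔n j (∈⇒≤maxVarₗ l k∈l)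
∈⇒≤maxVarₗ (iid ∷ l)    (there k∈l) = ∈⇒≤maxVarₗ l k∈l

Occurs⇒≤maxVar : ∀ {k} F → Occurs k F → k ≤ maxVar F
Occurs⇒≤maxVar (~ A)        o        = Occurs⇒≤maxVar A o
Occurs⇒≤maxVar (A ∧' B)     (inj₁ o) = m≤n⇒m≤n⊔o (maxVar B) (Occurs⇒≤maxVar A o)
Occurs⇒≤maxVar (A ∧' B)     (inj₂ o) = m≤n⇒m≤o⊔n (maxVar A) (Occurs⇒≤maxVar B o)
Occurs⇒≤maxVar (A ∨' B)     (inj₁ o) = m≤n⇒m≤n⊔o (maxVar B) (Occurs⇒≤maxVar A o)
Occurs⇒≤maxVar (A ∨' B)     (inj₂ o) = m≤n⇒m≤o⊔n (maxVar A) (Occurs⇒≤maxVar B o)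
Occurs⇒≤maxVar (A ⇒ B)      (inj₁ o) = m≤n⇒m≤n⊔o (maxVar B) (Occurs⇒≤maxVar A o)
Occurs⇒≤maxVar (A ⇒ B)      (inj₂ o) = m≤n⇒m≤o⊔n (maxVar A) (Occurs⇒≤maxVar B o)
Occurs⇒≤maxVar (□⟨ a ⟩ A)   (inj₁ o) = m≤n⇒m≤n⊔o (maxVar A) (∈⇒≤maxVarₗ (seq a) o)
Occurs⇒≤maxVar (□⟨ a ⟩ A)   (inj₂ o) = m≤n⇒m≤o⊔n (maxVarₗ (seq a)) (Occurs⇒≤maxVar A o)
Occurs⇒≤maxVar (A ▷⟨ a ⟩ B) (inj₁ o) =
  m≤n⇒m≤n⊔o (maxVarₗ (seq a) ⊔ maxVar B) (Occurs⇒≤maxVar A o)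
Occurs⇒≤maxVar (A ▷⟨ a ⟩ B) (inj₂ (inj₁ o)) =
  m≤n⇒m≤o⊔n (maxVar A) (m≤n⇒m≤n⊔o (maxVar B) (∈⇒≤maxVarₗ (seq a) o))
Occurs⇒≤maxVar (A ▷⟨ a ⟩ B) (inj₂ (inj₂ o)) =
  m≤n⇒m≤o⊔n (maxVar A) (m≤n⇒m≤o⊔n (maxVarₗ (seq a)) (Occurs⇒≤maxVar B o))

fresh : Formula → ℕ
fresh F = suc (maxVar F)

fresh-¬Occurs : ∀ F → ¬ Occurs (fresh F) F
fresh-¬Occurs F o = 1+n≰n (Occurs⇒≤maxVar F o)

-- For 𝔞 = ε every variable is fresh for 𝔞, and the label 𝔞,k is single k.
ruleP-fresh : ∀ b H A B C (Δ : ℕ → List Formula) →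
  (∀ k → All (PSide ε k λ ()) (Δ k)) →
  (∀ k → FIL⊢ ⋀ (H ∷ Δ k ++ □⟨ b ⟩ (A ▷⟨ single (ivar k) ⟩ B) ∷ []) ⇒ C) →
  FIL⊢ H ∧' (A ▷ B) ⇒ C
ruleP-fresh b H A B C Δ Δ-sides premise =
  schema (p₀ & p₁ ⊃ p₀ & (p₁ & tt)) (H ∷ (A ▷ B) ∷ [])
  ⨾ ruleP ε b k (H ∷ []) (Δ k) A B C (λ ())
      ((λ o → k∉ (inj₁ (inj₁ o))) ∷ [])
      (λ o → k∉ (inj₁ (inj₂ (inj₁ o))))
      (λ o → k∉ (inj₁ (inj₂ (inj₂ (inj₂ o)))))
      (λ o → k∉ (inj₂ o))
      (Δ-sides k) (premise k)
  where
  k : ℕ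
  k = fresh (H ∧' (A ▷ B) ⇒ C)
  k∉ : ¬ Occurs k (H ∧' (A ▷ B) ⇒ C)
  k∉ = fresh-¬Occurs (H ∧' (A ▷ B) ⇒ C)

▷-transfer : ∀ b {E A B Y Z} →
  (∀ k → FIL⊢ (A ▷⟨ single (ivar k) ⟩ B) ∧' Y ⇒ ◇⟨ single (ivar k) ⟩ Z) →
  FIL⊢ (E ▷⟨ b ⟩ Y) ∧' (A ▷ B) ⇒ E ▷ Z
▷-transfer b {E} {A} {B} {Y} {Z} ▷∧Y⇒◇ =
  ruleP-fresh b (E ▷⟨ b ⟩ Y) A B (E ▷ Z)
    (λ k → (E ▷⟨ single (ivar k) ⟩ Z ⇒ E ▷ Z) ∷ []) (λ _ → rhd-side E Z ∷ [])
    λ k → ⇒-app (∧-elimʳ ⨾ ∧-elimˡ)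
                (⟨ ∧-elimˡ , ∧-elimʳ ⨾ ∧-elimʳ ⨾ ∧-elimˡ ⨾ □-mono b (⇒-curry (▷∧Y⇒◇ k)) ⟩
                 ⨾ ▷-relabel b (single (ivar k)))

▷∧¬▷¬∧▷⇒◇ : ∀ b {A B C E X A′ B′ Y Z} →
  FIL⊢ X ⇒ A′ ▷ B′ → FIL⊢ Y ⇒ ◇ A′ →
  (∀ k → FIL⊢ (A′ ▷⟨ single (ivar k) ⟩ B′) ∧' Y ⇒ ◇⟨ single (ivar k) ⟩ Z) →
  FIL⊢ (A ▷⟨ b ⟩ (B ∧' X)) ∧' (~ (A ▷ ~ C) ∧' (E ▷ Y))
       ⇒ ◇⟨ b ⟩ (B ∧' X ∧' □ C ∧' (E ▷ A′) ∧' (E ▷ Z))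
▷∧¬▷¬∧▷⇒◇ b {A} {B} {C} {E} {X} {A′} {B′} {Y} {Z} X⇒▷ Y⇒◇ ▷∧Y⇒◇ =
  schema (p₀ & (p₁ & p₂) ⊃ (p₀ & p₁) & p₂) (G ∷ N ∷ (E ▷ Y) ∷ [])
  ⨾ ruleP-fresh b (G ∧' N) E Y _ (λ _ → []) (λ _ → []) premise
  where
  G N B″ : Formula
  G  = A ▷⟨ b ⟩ (B ∧' X)
  N  = ~ (A ▷ ~ C)
  B″ = B ∧' X ∧' (E ▷ A′) ∧' (E ▷ Z)
  strengthen : ∀ k → FIL⊢ E ▷⟨ single (ivar k) ⟩ Y ⇒ (B ∧' X ⇒ B″)
  strengthen k = ⇒-curry
    ⟨ ⟨ ∧-elimʳ , ∧-elimˡ ⨾ ▷-monoʳ (single (ivar k)) Y⇒◇ ⨾ axJ5 (single (ivar k)) ε E A′ ⟩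
    , ⟨ ∧-elimˡ , ∧-elimʳ ⨾ ∧-elimʳ ⨾ X⇒▷ ⟩ ⨾ ▷-transfer (single (ivar k)) ▷∧Y⇒◇ ⟩
  premise : ∀ k → FIL⊢ (G ∧' N) ∧' (□⟨ b ⟩ (E ▷⟨ single (ivar k) ⟩ Y) ∧' ⊤')
                       ⇒ ◇⟨ b ⟩ (B ∧' X ∧' □ C ∧' (E ▷ A′) ∧' (E ▷ Z))
  premise k =
    ⟨ ⟨ ∧-elimˡ ⨾ ∧-elimˡ , ∧-elimʳ ⨾ ∧-elimˡ ⨾ □-mono b (strengthen k) ⟩ ⨾ axJ2' b A (B ∧' X) B″
    , ∧-elimˡ ⨾ ∧-elimʳ ⟩
    ⨾ ▷∧¬▷¬⇒◇∧□ b A B″ C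
    ⨾ ◇-mono b (schema (((p₀ & p₁) & p₂) & p₃ ⊃ ((p₀ & p₃) & p₁) & p₂)
                       ((B ∧' X) ∷ (E ▷ A′) ∷ (E ▷ Z) ∷ □ C ∷ []))

module _ (A B C E : ℕ → Formula) where
  open Seqs A B C E

  X⇒▷B∧Xpred : ∀ m → FIL⊢ X m ⇒ A m ▷ (B m ∧' Xpred m)
  X⇒▷B∧Xpred zero    = ▷-monoʳ ε (schema (p₀ ⊃ p₀ & tt) (B zero ∷ []))
  X⇒▷B∧Xpred (suc m) = ⇒-refl

  Y⇒◇A : ∀ m → FIL⊢ Y m ⇒ ◇ A m
  Y⇒◇A zero    = ¬▷¬⇒◇ (A zero) (C zero)
  Y⇒◇A (suc m) = ∧-elimˡ ⨾ ¬▷¬⇒◇ (A (suc m)) (C (suc m))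

mainTheorem17 : (A B C E : ℕ → Formula) (n k : ℕ) →
    let open Seqs A B C E in
    FIL⊢ (A n ▷⟨ single (ivar k) ⟩ (B n ∧' Xpred n)) ∧' Y n ⇒ ◇⟨ single (ivar k) ⟩ Z n
mainTheorem17 A B C E zero k =
  ▷∧¬▷¬⇒◇∧□ (single (ivar k)) (A zero) (B zero ∧' ⊤') (C zero)
  ⨾ ◇-mono (single (ivar k)) (schema ((p₀ & tt) & p₁ ⊃ p₀ & p₁) (B zero ∷ □ C zero ∷ []))
mainTheorem17 A B C E (suc m) k =
  ▷∧¬▷¬∧▷⇒◇ (single (ivar k)) (X⇒▷B∧Xpred A B C E m) (Y⇒◇A A B C E m) (mainTheorem17 A B C E m)
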